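{- For each $k\ge 2$ there exists a tournament $T$ such that $T$ is $k$-freezable and $\mathcal{D}_k(T)$ has $k!$ isolated vertices. In particular, for all $n\geq 4$, the tournament $\vec{C}_{2n+1}\langle n\rangle-\{0\}$ is $2$-freezable and $\mathcal{D}_2(\vec{C}_{2n+1}\langle n\rangle-\{0\})$ consists of two isolated vertices.
   Context: For a digraph $D$ and a positive integer $k$, a $k$-coloring of $D$ is a function $\alpha\colon V(D)\to\{1,\dots,k\}$ such that every color class $C_i^\alpha=\{x:\alpha(x)=i\}$ (possibly empty) induces an acyclic subdigraph. The $k$-dicoloring graph $\mathcal{D}_k(D)$ has the $k$-colorings of $D$ as vertices, two being adjacent iff they differ on exactly one vertex. $D$ is $k$-freezable if $\mathcal{D}_k(D)$ has an isolated vertex. For $n\ge2$, $\vec{C}_{2n+1}\langle n\rangle$ is the tournament with vertex set $\mathbb{Z}_{2n+1}$ whose arcs are $(a,a+j)$ for all $a\in\mathbb{Z}_{2n+1}$ and $j\in\{1,\dots,n-1\}$, together with $(a,a-n)$ for all $a\in\mathbb{Z}_{2n+1}$ (i.e. the cyclic circulant tournament with jumps $1,\dots,n$ with the jump $n$ reversed). $\vec{C}_{2n+1}\langle n\rangle-\{0\}$ denotes the subtournament obtained by deleting vertex $0$. -}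

module Defs where

open import Data.Nat using (ℕ; zero; suc; _+_; _*_; _∸_; _%_; _≤ᵇ_; _≡ᵇ_; _!)
open import Data.Bool using (Bool; true; false; T; not; _∧_; _∨_)
open import Data.Fin using (Fin; toℕ) renaming (suc to fsuc)
open import Data.Vec using (Vec; lookup)
open import Data.List using (List; length)
open import Data.List.Membership.Propositional using (_∈_)
open import Data.List.Relation.Unary.Unique.Propositional using (Unique)
open import Data.List.Relation.Unary.All using (All)
open import Data.Product using (Σ; ∃; _×_; _,_)
open import Relation.Nullary using (¬_)
open import Relation.Binary.PropositionalEquality using (_≡_; _≢_)
open import Relation.Binary.Construct.Closure.Transitive using (TransClosure)
open import Function.Bundles using (_⇔_)

record Digraph : Set where
  field
    n   : ℕ
    arc : Fin n → Fin n → Bool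

open Digraph public

V : Digraph → Set
V D = Fin (n D)

Arc : (D : Digraph) → V D → V D → Set
Arc D x y = T (arc D x y)

IsTournament : Digraph → Set
IsTournament D =
  (∀ x → arc D x x ≡ false) ×
  (∀ x y → x ≢ y → arc D x y ≡ not (arc D y x))

InducedArc : (D : Digraph) → (V D → Set) → V D → V D → Set
InducedArc D S x y = S x × S y × Arc D x y

Acyclic : (D : Digraph) → (V D → Set) → Set
Acyclic D S = ∀ x → ¬ TransClosure (InducedArc D S) x x

-- Colorings with colors Fin k (standing for {1,...,k}), represented as vectors.
Coloring : ℕ → Digraph → Set
Coloring k D = Vec (Fin k) (n D)

ColorClass : ∀ {k} (D : Digraph) → Coloring k D → Fin k → V D → Set
ColorClass D α i x = lookup α x ≡ i

IsKColoring : (k : ℕ) (D : Digraph) → Coloring k D → Set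
IsKColoring k D α = ∀ i → Acyclic D (ColorClass D α i)

DifferOnExactlyOne : ∀ {k} (D : Digraph) → Coloring k D → Coloring k D → Set
DifferOnExactlyOne D α β =
  ∃ λ v → (lookup α v ≢ lookup β v) × (∀ w → w ≢ v → lookup α w ≡ lookup β w)

Adjacent : (k : ℕ) (D : Digraph) → Coloring k D → Coloring k D → Set
Adjacent k D α β = IsKColoring k D α × IsKColoring k D β × DifferOnExactlyOne D α β

Isolated : (k : ℕ) (D : Digraph) → Coloring k D → Set
Isolated k D α = IsKColoring k D α × (∀ β → ¬ Adjacent k D α β)

Freezable : ℕ → Digraph → Set
Freezable k D = ∃ λ α → Isolated k D α

HasExactlyIsolated : ℕ → (k : ℕ) → Digraph → Set
HasExactlyIsolated m k D =
  Σ (List (Coloring k D)) λ L →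
    Unique L × length L ≡ m × (∀ α → Isolated k D α ⇔ α ∈ L)

ConsistsOfIsolated : ℕ → (k : ℕ) → Digraph → Set
ConsistsOfIsolated m k D =
  Σ (List (Coloring k D)) λ L →
    Unique L × length L ≡ m × (∀ α → IsKColoring k D α ⇔ α ∈ L)
    × All (Isolated k D) L

-- C⃗_{2n+1}⟨n⟩ on ℤ_{2n+1} = Fin (2n+1): arc a → b iff (b - a) mod (2n+1) ∈ {1,…,n-1}
-- or (a - b) mod (2n+1) = n, i.e. (b - a) mod (2n+1) = n+1.
circArc : (n : ℕ) → Fin (suc (2 * n)) → Fin (suc (2 * n)) → Bool
circArc n a b =
  let d = (toℕ b + suc (2 * n) ∸ toℕ a) % suc (2 * n)
  in ((1 ≤ᵇ d) ∧ (d ≤ᵇ n ∸ 1)) ∨ (d ≡ᵇ suc n)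

Circ : ℕ → Digraph
Circ n = record { n = suc (2 * n) ; arc = circArc n }

-- C⃗_{2n+1}⟨n⟩ − {0}: vertex x ∈ Fin (2n) stands for x+1 ∈ ℤ_{2n+1}.
CircMinus0 : ℕ → Digraph
CircMinus0 n = record { n = 2 * n ; arc = λ x y → circArc n (fsuc x) (fsuc y) }

{-# OPTIONS --safe #-}
-- The tournament Tₖ has vertices X_i (X ∈ {A, B, C}, i < k). Its arcs make A ∪ C transitive and each
-- triple {A_i, B_i, C_i} transitive, and every vertex X_i forms a directed triangle with two vertices of
-- any other index m. Hence colouring X_i by p(i) for a permutation p of the k colours is a dicolouring in
-- which recolouring any single vertex closes a monochromatic triangle, i.e. an isolated one. Conversely,
-- in a tournament an isolated dicolouring is one where every single recolouring closes a monochromatic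
-- triangle; since every triangle meets B, this forces B to carry all k colours, and then an induction
-- upwards along A and downwards along C shows that A_i and C_i carry the colour of B_i.
--
-- Write the vertices of C⃗_{2n+1}⟨n⟩ − {0} as 1, …, 2n. For u ≤ n and 0 < i < n the vertices u, u + i,
-- u + n form a directed triangle; together with a few triangles using the reversed jump n + 1 this shows
-- that every 2-dicolouring gives u and u + n different colours, and u and u + 1 the same colour when
-- u + 1 ≤ n. So the only 2-dicolourings colour {1, …, n} and {n + 1, …, 2n} differently; they are
-- dicolourings since each half is a transitive tournament, and isolated since they differ everywhere.
module Submission where

open import Defs
open import Data.Bool using (Bool; true; false; T; not; _∧_; _∨_)
open import Data.Bool.Properties using (T-∧; T-∨)
open import Data.Empty using (⊥-elim)
open import Data.Fin using (Fin; zero; suc; toℕ; fromℕ; fromℕ<; opposite; punchIn; punchOut; combine; remQuot)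
  renaming (_<_ to _<ᶠ_; _>_ to _>ᶠ_)
open import Data.Fin.Induction using (<-wellFounded; >-wellFounded)
open import Data.Fin.Properties
  using (any?; injective⇒≤; punchOut-injective; punchIn-injective; punchInᵢ≢i; punchIn-punchOut;
         toℕ-injective; toℕ-fromℕ; toℕ-fromℕ<; toℕ<n; toℕ≤pred[n]; remQuot-combine; combine-remQuot)
  renaming (_≟_ to _≟ᶠ_; <⇒≢ to <⇒≢ᶠ; suc-injective to suc-injectiveᶠ)
open import Data.List using (List; []; _∷_; _++_; length; map; cartesianProductWith; allFin)
open import Data.List.Properties using (length-++; length-map; length-tabulate)
open import Data.List.Membership.Propositional using (_∈_)
open import Data.List.Membership.Propositional.Properties
  using (∈-cartesianProductWith⁺; ∈-cartesianProductWith⁻; ∈-allFin; ∈-map⁺; ∈-map⁻)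
import Data.List.Relation.Unary.All as All
import Data.List.Relation.Unary.AllPairs as AllPairs
open import Data.List.Relation.Unary.Any using (here; there)
open import Data.List.Relation.Unary.Unique.Propositional using (Unique)
open import Data.List.Relation.Unary.Unique.Propositional.Properties
  using (cartesianProductWith⁺; allFin⁺) renaming (map⁺ to unique-map⁺)
open import Data.Nat using (ℕ; zero; suc; _+_; _*_; _∸_; _%_; _<_; _≤_; _!; _≤ᵇ_; _≡ᵇ_; z≤n; s≤s; _<?_; _≤?_)
open import Data.Nat.DivMod using ([m+n]%n≡m%n; m<n⇒m%n≡m; n%n≡0)
open import Data.Nat.Properties
open import Algebra.Properties.CommutativeSemigroup +-commutativeSemigroup using (xy∙z≈y∙xz)
open import Data.Product using (∃; ∃₂; _×_; _,_; proj₁; proj₂; uncurry; map₂)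
open import Data.Sum using (_⊎_; inj₁; inj₂)
open import Data.Unit using (tt)
open import Data.Vec using (Vec; lookup; tabulate; _[_]≔_)
  renaming ([] to []ᵥ; _∷_ to _∷ᵥ_; map to mapᵥ; allFin to allFinᵥ)
open import Data.Vec.Properties
  using (lookup∘update; lookup∘update′; lookup-map; ∷-injectiveˡ; ∷-injectiveʳ;
         tabulate∘lookup; tabulate-cong; lookup∘tabulate; lookup-allFin)
open import Function using (_∘_)
open import Function.Bundles using (_⇔_; mk⇔; Equivalence)
open import Function.Definitions using (Injective)
import Induction.WellFounded as WF
open import Level using (0ℓ)
open import Relation.Binary.Construct.Closure.Transitive using (TransClosure; [_]; _∷_)
open import Relation.Binary.Definitions using (tri<; tri≈; tri>)
open import Relation.Binary.PropositionalEquality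
open import Relation.Nullary using (¬_; Dec; yes; no)
open import Relation.Nullary.Decidable using (True; ⌊_⌋; toWitness; fromWitness; decidable-stable; _×-dec_)
open import Relation.Nullary.Decidable.Core using (T?)

-- Dicolourings of tournaments

Triangle : (D : Digraph) → V D → V D → V D → Set
Triangle D a b c = Arc D a b × Arc D b c × Arc D c a

rank⇒acyclic : (D : Digraph) (S : V D → Set) (f : V D → ℕ) →
               (∀ {x y} → S x → S y → Arc D x y → f x < f y) → Acyclic D S
rank⇒acyclic D S f increasing x cycle = <-irrefl refl (rank-< cycle)
  where
  rank-< : ∀ {x y} → TransClosure (InducedArc D S) x y → f x < f y
  rank-< [ sx , sy , xy ]        = increasing sx sy xy
  rank-< ((sx , sy , xy) ∷ walk) = <-trans (increasing sx sy xy) (rank-< walk)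

no-monochromatic-triangle : ∀ {k} (D : Digraph) (α : Coloring k D) → IsKColoring k D α →
                            ∀ {a b c} → lookup α a ≡ lookup α b → lookup α b ≡ lookup α c →
                            ¬ Triangle D a b c
no-monochromatic-triangle D α α-col {a} {b} {c} ab bc (a⟶b , b⟶c , c⟶a) =
  α-col (lookup α a) a ((refl , sym ab , a⟶b) ∷ (sym ab , sym ac , b⟶c) ∷ [ sym ac , refl , c⟶a ])
  where
  ac = trans ab bc

Frozen : ∀ {k} (D : Digraph) → Coloring k D → Set
Frozen {k} D α = ∀ v (j : Fin k) → lookup α v ≢ j →
                 ∃₂ λ x y → lookup α x ≡ j × lookup α y ≡ j × Triangle D v x y

frozen⇒isolated : ∀ {k} (D : Digraph) (α : Coloring k D) →
                  IsKColoring k D α → Frozen D α → Isolated k D α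
frozen⇒isolated D α α-col frozen = α-col , not-adjacent
  where
  not-adjacent : ∀ β → ¬ Adjacent _ D α β
  not-adjacent β (_ , β-col , v , αv≢βv , agree)
    with x , y , αx , αy , vxy ← frozen v (lookup β v) αv≢βv =
    no-monochromatic-triangle D β β-col (sym (recoloured αx)) (trans (recoloured αx) (sym (recoloured αy))) vxy
    where
    recoloured : ∀ {x} → lookup α x ≡ lookup β v → lookup β x ≡ lookup β v
    recoloured {x} αx = trans (sym (agree x λ { refl → αv≢βv αx })) αx

module Tournament (D : Digraph) (tournament : IsTournament D) where

  irreflexive : ∀ {x y} → Arc D x y → x ≢ y
  irreflexive {x} x⟶x refl = subst T (proj₁ tournament x) x⟶x

  asymmetric : ∀ {x y} → Arc D x y → ¬ Arc D y x
  asymmetric {x} {y} x⟶y = not-both (proj₂ tournament x y (irreflexive x⟶y)) x⟶y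
    where
    not-both : ∀ {a b} → a ≡ not b → T a → ¬ T b
    not-both {true} {true} ()

  complete : ∀ {x y} → x ≢ y → ¬ Arc D x y → Arc D y x
  complete {x} {y} x≢y = one-of (proj₂ tournament x y x≢y)
    where
    one-of : ∀ {a b} → a ≡ not b → ¬ T a → T b
    one-of {true}          _  a-false = ⊥-elim (a-false tt)
    one-of {false} {true}  _  _       = tt

  Triangle-in : (V D → Set) → Set
  Triangle-in S = ∃₂ λ a b → ∃ λ c → S a × S b × S c × Triangle D a b c

  walk⇒arc-or-triangle : ∀ {S x y} → TransClosure (InducedArc D S) x y → InducedArc D S x y ⊎ Triangle-in S
  walk⇒arc-or-triangle [ x⟶y ] = inj₁ x⟶y
  walk⇒arc-or-triangle {S} {x} {y} (_∷_ {y = z} (sx , sz , x⟶z) walk) with walk⇒arc-or-triangle walk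
  ... | inj₂ triangle = inj₂ triangle
  ... | inj₁ (_ , sy , z⟶y) with x ≟ᶠ y
  ...   | yes refl = ⊥-elim (asymmetric x⟶z z⟶y)
  ...   | no x≢y with T? (arc D x y)
  ...     | yes x⟶y = inj₁ (sx , sy , x⟶y)
  ...     | no x↛y  = inj₂ (x , z , y , sx , sz , sy , x⟶z , z⟶y , complete x≢y x↛y)

  closed-walk⇒triangle : ∀ {S x} → TransClosure (InducedArc D S) x x → Triangle-in S
  closed-walk⇒triangle walk with walk⇒arc-or-triangle walk
  ... | inj₁ (_ , _ , x⟶x) = ⊥-elim (irreflexive x⟶x refl)
  ... | inj₂ triangle = triangle

  isolated⇒frozen : ∀ {k} (α : Coloring k D) → Isolated k D α → Frozen D α
  isolated⇒frozen {k} α (α-col , isolated) v j αv≢j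
    with any? (λ x → any? (λ y → (lookup α x ≟ᶠ j) ×-dec (lookup α y ≟ᶠ j)
                                   ×-dec T? (arc D v x) ×-dec T? (arc D x y) ×-dec T? (arc D y v)))
  ... | yes found = found
  -- otherwise recolouring v to j is a dicolouring: a triangle in a colour class of β either avoids v,
  -- and is then monochromatic for α, or passes through v and is one of the excluded j-triangles
  ... | no none = ⊥-elim (isolated β (α-col , β-col , v , αv≢βv , λ w w≢v → sym (β-agrees w≢v)))
    where
    β : Coloring k D
    β = α [ v ]≔ j

    βv : lookup β v ≡ j
    βv = lookup∘update v α j

    αv≢βv : lookup α v ≢ lookup β v
    αv≢βv e = αv≢j (trans e βv)

    β-agrees : ∀ {w} → w ≢ v → lookup β w ≡ lookup α w
    β-agrees w≢v = lookup∘update′ w≢v α j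

    no-j-triangle : ∀ {x y} → lookup β x ≡ j → lookup β y ≡ j → ¬ Triangle D v x y
    no-j-triangle βx βy vxy@(v⟶x , _ , y⟶v) =
      none (_ , _ , trans (sym (β-agrees (irreflexive v⟶x ∘ sym))) βx ,
                    trans (sym (β-agrees (irreflexive y⟶v))) βy , vxy)

    β-col : IsKColoring k D β
    β-col i x cycle with closed-walk⇒triangle cycle
    ... | a , b , c , βa , βb , βc , abc@(a⟶b , b⟶c , c⟶a) with a ≟ᶠ v | b ≟ᶠ v | c ≟ᶠ v
    ... | yes refl | _ | _ = no-j-triangle (trans βb (trans (sym βa) βv)) (trans βc (trans (sym βa) βv)) abc
    ... | no _ | yes refl | _ = no-j-triangle (trans βc (trans (sym βb) βv)) (trans βa (trans (sym βb) βv)) (b⟶c , c⟶a , a⟶b)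
    ... | no _ | no _ | yes refl = no-j-triangle (trans βa (trans (sym βc) βv)) (trans βb (trans (sym βc) βv)) (c⟶a , a⟶b , b⟶c)
    ... | no a≢v | no b≢v | no c≢v =
      no-monochromatic-triangle D α α-col
        (trans (sym (β-agrees a≢v)) (trans (trans βa (sym βb)) (β-agrees b≢v)))
        (trans (sym (β-agrees b≢v)) (trans (trans βb (sym βc)) (β-agrees c≢v))) abc

-- Self-maps and permutations of Fin k

Onto : ∀ {m n} → (Fin m → Fin n) → Set
Onto f = ∀ y → ∃ λ x → f x ≡ y

injective⇒surjective : ∀ {n} {f : Fin n → Fin n} → Injective _≡_ _≡_ f → Onto f
injective⇒surjective {suc n} {f} f-inj y with any? (λ x → f x ≟ᶠ y)
... | yes hit = hit
... | no miss = ⊥-elim (1+n≰n (injective⇒≤ squeezed-injective))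
  where
  squeezed : Fin (suc n) → Fin n
  squeezed x = punchOut {i = y} (miss ∘ (x ,_) ∘ sym)

  squeezed-injective : Injective _≡_ _≡_ squeezed
  squeezed-injective {a} {b} = f-inj ∘ punchOut-injective (miss ∘ (a ,_) ∘ sym) (miss ∘ (b ,_) ∘ sym)

surjective⇒injective : ∀ {n} {f : Fin n → Fin n} → Onto f → Injective _≡_ _≡_ f
surjective⇒injective {n} {f} f-surj {x} {y} fx≡fy =
  trans (sym (section-retracts x)) (trans (cong section fx≡fy) (section-retracts y))
  where
  section : Fin n → Fin n
  section z = proj₁ (f-surj z)

  f∘section : ∀ z → f (section z) ≡ z
  f∘section z = proj₂ (f-surj z)

  section-retracts : ∀ x → section (f x) ≡ x
  section-retracts x with w , refl ← injective⇒surjective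
    (λ {a} {b} e → trans (sym (f∘section a)) (trans (cong f e) (f∘section b))) x
    = cong section (f∘section w)

lookup-extensionality : ∀ {A : Set} {n} {xs ys : Vec A n} → (∀ i → lookup xs i ≡ lookup ys i) → xs ≡ ys
lookup-extensionality {xs = xs} {ys} same = trans (sym (tabulate∘lookup xs)) (trans (tabulate-cong same) (tabulate∘lookup ys))

length-cartesianProductWith : ∀ {A₁ A₂ A₃ : Set} (f : A₁ → A₂ → A₃) xs ys →
                              length (cartesianProductWith f xs ys) ≡ length xs * length ys
length-cartesianProductWith f []       ys = refl
length-cartesianProductWith f (x ∷ xs) ys = begin
  length (map (f x) ys ++ cartesianProductWith f xs ys)  ≡⟨ length-++ (map (f x) ys) ⟩
  length (map (f x) ys) + length (cartesianProductWith f xs ys)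
    ≡⟨ cong₂ _+_ (length-map (f x) ys) (length-cartesianProductWith f xs ys) ⟩
  length ys + length xs * length ys                      ∎
  where open ≡-Reasoning

prepend : ∀ {k} → Fin (suc k) → Vec (Fin k) k → Vec (Fin (suc k)) (suc k)
prepend i p = i ∷ᵥ mapᵥ (punchIn i) p

permutations : ∀ k → List (Vec (Fin k) k)
permutations zero    = []ᵥ ∷ []
permutations (suc k) = cartesianProductWith prepend (allFin (suc k)) (permutations k)

length-permutations : ∀ k → length (permutations k) ≡ k !
length-permutations zero    = refl
length-permutations (suc k) =
  trans (length-cartesianProductWith prepend (allFin (suc k)) (permutations k))
        (cong₂ _*_ (length-tabulate {n = suc k} (λ i → i)) (length-permutations k))

prepend-injective : ∀ {k} {i j : Fin (suc k)} {p q : Vec (Fin k) k} →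
                    prepend i p ≡ prepend j q → i ≡ j × p ≡ q
prepend-injective {i = i} {p = p} {q} e with refl ← ∷-injectiveˡ e = refl , map-injective p q (∷-injectiveʳ e)
  where
  map-injective : ∀ {m} (p q : Vec _ m) → mapᵥ (punchIn i) p ≡ mapᵥ (punchIn i) q → p ≡ q
  map-injective []ᵥ       []ᵥ       _ = refl
  map-injective (x ∷ᵥ p) (y ∷ᵥ q) e =
    cong₂ _∷ᵥ_ (punchIn-injective i x y (∷-injectiveˡ e)) (map-injective p q (∷-injectiveʳ e))

permutations-unique : ∀ k → Unique (permutations k)
permutations-unique zero    = All.[] AllPairs.∷ AllPairs.[]
permutations-unique (suc k) =
  cartesianProductWith⁺ prepend prepend-injective (allFin⁺ (suc k)) (permutations-unique k)

∈-permutations⁻ : ∀ {k} {p : Vec (Fin k) k} → p ∈ permutations k → Injective _≡_ _≡_ (lookup p)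
∈-permutations⁻ {zero} {[]ᵥ} _ {()}
∈-permutations⁻ {suc k} p∈ with i , q , _ , q∈ , refl ← ∈-cartesianProductWith⁻ prepend (allFin (suc k)) (permutations k) p∈
  = injective
  where
  shifted : ∀ a → lookup (mapᵥ (punchIn i) q) a ≡ punchIn i (lookup q a)
  shifted a = lookup-map a (punchIn i) q

  injective : Injective _≡_ _≡_ (lookup (prepend i q))
  injective {zero}  {zero}  _ = refl
  injective {zero}  {suc b} e = ⊥-elim (punchInᵢ≢i i (lookup q b) (sym (trans e (shifted b))))
  injective {suc a} {zero}  e = ⊥-elim (punchInᵢ≢i i (lookup q a) (trans (sym (shifted a)) e))
  injective {suc a} {suc b} e =
    cong suc (∈-permutations⁻ q∈ (punchIn-injective i _ _ (trans (sym (shifted a)) (trans e (shifted b)))))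

∈-permutations⁺ : ∀ {k} {p : Vec (Fin k) k} → Injective _≡_ _≡_ (lookup p) → p ∈ permutations k
∈-permutations⁺ {zero}  {[]ᵥ}     _ = here refl
∈-permutations⁺ {suc k} {i ∷ᵥ p} injective =
  subst (_∈ permutations (suc k)) prepend-rest
        (∈-cartesianProductWith⁺ prepend (∈-allFin i) (∈-permutations⁺ rest-injective))
  where
  i≢p : ∀ a → i ≢ lookup p a
  i≢p a e with () ← injective {zero} {suc a} e

  rest : Vec (Fin k) k
  rest = tabulate (λ a → punchOut (i≢p a))

  rest-injective : Injective _≡_ _≡_ (lookup rest)
  rest-injective {a} {b} e = suc-injectiveᶠ (injective (punchOut-injective (i≢p a) (i≢p b)
    (trans (sym (lookup∘tabulate _ a)) (trans e (lookup∘tabulate _ b)))))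

  prepend-rest : prepend i rest ≡ i ∷ᵥ p
  prepend-rest = cong (i ∷ᵥ_) (lookup-extensionality punchIn-rest)
    where
    punchIn-rest : ∀ a → lookup (mapᵥ (punchIn i) rest) a ≡ lookup p a
    punchIn-rest a = trans (lookup-map a (punchIn i) rest)
                           (trans (cong (punchIn i) (lookup∘tabulate _ a)) (punchIn-punchOut (i≢p a)))

Block : Set
Block = Fin 3

pattern A = zero
pattern B = suc zero
pattern C = suc (suc zero)

-- The tournament Tₖ

-- Beats (X , i) (Y , j) is the arc X_i → Y_j.
Beats : Block × ℕ → Block × ℕ → Set
Beats (A , i) (A , j) = i < j
Beats (A , i) (B , j) = j ≤ i
Beats (A , i) (C , j) = i ≤ j
Beats (B , i) (A , j) = j < i
Beats (B , i) (B , j) = i < j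
Beats (B , i) (C , j) = j ≤ i
Beats (C , i) (A , j) = i < j
Beats (C , i) (B , j) = j < i
Beats (C , i) (C , j) = i < j

beats? : ∀ u v → Dec (Beats u v)
beats? (A , i) (A , j) = i <? j
beats? (A , i) (B , j) = j ≤? i
beats? (A , i) (C , j) = i ≤? j
beats? (B , i) (A , j) = j <? i
beats? (B , i) (B , j) = i <? j
beats? (B , i) (C , j) = j ≤? i
beats? (C , i) (A , j) = i <? j
beats? (C , i) (B , j) = j <? i
beats? (C , i) (C , j) = i <? j

beats-asym : ∀ {u v} → Beats u v → ¬ Beats v u
beats-asym {A , _} {A , _} = <-asym
beats-asym {A , _} {B , _} = ≤⇒≯
beats-asym {A , _} {C , _} = ≤⇒≯
beats-asym {B , _} {A , _} = <⇒≱
beats-asym {B , _} {B , _} = <-asym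
beats-asym {B , _} {C , _} = ≤⇒≯
beats-asym {C , _} {A , _} = <⇒≱
beats-asym {C , _} {B , _} = <⇒≱
beats-asym {C , _} {C , _} = <-asym

beats-total : ∀ {u v} → u ≢ v → ¬ Beats u v → Beats v u
beats-total {A , i} {A , j} u≢v i≮j = ≤∧≢⇒< (≮⇒≥ i≮j) (λ { refl → u≢v refl })
beats-total {A , _} {B , _} _ = ≰⇒>
beats-total {A , _} {C , _} _ = ≰⇒>
beats-total {B , _} {A , _} _ = ≮⇒≥
beats-total {B , i} {B , j} u≢v i≮j = ≤∧≢⇒< (≮⇒≥ i≮j) (λ { refl → u≢v refl })
beats-total {B , _} {C , _} _ = ≰⇒>
beats-total {C , _} {A , _} _ = ≮⇒≥
beats-total {C , _} {B , _} _ = ≮⇒≥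
beats-total {C , i} {C , j} u≢v i≮j = ≤∧≢⇒< (≮⇒≥ i≮j) (λ { refl → u≢v refl })

_≟B : (X : Block) → Dec (X ≡ B)
A ≟B = no λ ()
B ≟B = yes refl
C ≟B = no λ ()

Cycle : Block × ℕ → Block × ℕ → Block × ℕ → Set
Cycle u v w = Beats u v × Beats v w × Beats w u

-- A_0, C_0, A_1, C_1, … orders A ∪ C transitively
outside-B-acyclic : ∀ {X Y Z i j l} → X ≢ B → Y ≢ B → Z ≢ B → ¬ Cycle (X , i) (Y , j) (Z , l)
outside-B-acyclic X≢B Y≢B Z≢B (u⟶v , v⟶w , w⟶u) =
  <-irrefl refl (<-trans (ρ-increasing X≢B Y≢B u⟶v) (<-trans (ρ-increasing Y≢B Z≢B v⟶w) (ρ-increasing Z≢B X≢B w⟶u)))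
  where
  ρ : Block × ℕ → ℕ
  ρ (C , i) = suc (i + i)
  ρ (_ , i) = i + i

  ρ-increasing : ∀ {X Y i j} → X ≢ B → Y ≢ B → Beats (X , i) (Y , j) → ρ (X , i) < ρ (Y , j)
  ρ-increasing {A} {A} _ _ i<j = +-mono-< i<j i<j
  ρ-increasing {A} {C} _ _ i≤j = s≤s (+-mono-≤ i≤j i≤j)
  ρ-increasing {C} {A} {i} {j} _ _ i<j = subst (_≤ j + j) (cong suc (+-suc i i)) (+-mono-≤ i<j i<j)
  ρ-increasing {C} {C} _ _ i<j = s≤s (+-mono-< i<j i<j)
  ρ-increasing {B} B≢B _ = ⊥-elim (B≢B refl)
  ρ-increasing {_} {B} _ B≢B = ⊥-elim (B≢B refl)

cycle-meets-B : ∀ {X Y Z i j l} → X ≢ B → Cycle (X , i) (Y , j) (Z , l) → Y ≡ B ⊎ Z ≡ B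
cycle-meets-B {Y = B} _ _ = inj₁ refl
cycle-meets-B {Z = B} _ _ = inj₂ refl
cycle-meets-B {Y = A} {A} X≢B cycle = ⊥-elim (outside-B-acyclic X≢B (λ ()) (λ ()) cycle)
cycle-meets-B {Y = A} {C} X≢B cycle = ⊥-elim (outside-B-acyclic X≢B (λ ()) (λ ()) cycle)
cycle-meets-B {Y = C} {A} X≢B cycle = ⊥-elim (outside-B-acyclic X≢B (λ ()) (λ ()) cycle)
cycle-meets-B {Y = C} {C} X≢B cycle = ⊥-elim (outside-B-acyclic X≢B (λ ()) (λ ()) cycle)

same-index-beats : ∀ {X Y i} → Beats (X , i) (Y , i) → toℕ X < toℕ Y
same-index-beats {A} {A} i<i = ⊥-elim (<-irrefl refl i<i)
same-index-beats {A} {B} _ = s≤s z≤n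
same-index-beats {A} {C} _ = s≤s z≤n
same-index-beats {B} {A} i<i = ⊥-elim (<-irrefl refl i<i)
same-index-beats {B} {B} i<i = ⊥-elim (<-irrefl refl i<i)
same-index-beats {B} {C} _ = s≤s (s≤s z≤n)
same-index-beats {C} {A} i<i = ⊥-elim (<-irrefl refl i<i)
same-index-beats {C} {B} i<i = ⊥-elim (<-irrefl refl i<i)
same-index-beats {C} {C} i<i = ⊥-elim (<-irrefl refl i<i)

⌊⌋-false : ∀ {P : Set} (p? : Dec P) → ¬ P → ⌊ p? ⌋ ≡ false
⌊⌋-false (yes p) ¬p = ⊥-elim (¬p p)
⌊⌋-false (no _)  _  = refl

⌊⌋-exclusive : ∀ {P Q : Set} (p? : Dec P) (q? : Dec Q) → (P → ¬ Q) → (¬ P → Q) → ⌊ p? ⌋ ≡ not ⌊ q? ⌋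
⌊⌋-exclusive (yes p) (yes q) p⇒¬q _    = ⊥-elim (p⇒¬q p q)
⌊⌋-exclusive (yes _) (no _)  _    _    = refl
⌊⌋-exclusive (no _)  (yes _) _    _    = refl
⌊⌋-exclusive (no ¬p) (no ¬q) _    ¬p⇒q = ⊥-elim (¬q (¬p⇒q ¬p))

module BlockTournament (k : ℕ) where

  opaque
    vertex : Block → Fin k → Fin (3 * k)
    vertex = combine

  position : Fin (3 * k) → Block × ℕ
  position x = map₂ toℕ (remQuot {3} k x)

  Tₖ : Digraph
  Tₖ = record { n = 3 * k ; arc = λ x y → ⌊ beats? (position x) (position y) ⌋ }

  opaque
    unfolding vertex
    remQuot-vertex : ∀ X i → remQuot k (vertex X i) ≡ (X , i)
    remQuot-vertex = remQuot-combine

    vertex-remQuot : ∀ x → vertex (proj₁ (remQuot {3} k x)) (proj₂ (remQuot {3} k x)) ≡ x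
    vertex-remQuot = combine-remQuot {3} k

  position-vertex : ∀ X i → position (vertex X i) ≡ (X , toℕ i)
  position-vertex X i = cong (map₂ toℕ) (remQuot-vertex X i)

  position-injective : Injective _≡_ _≡_ position
  position-injective {x} {y} e = begin
    x                             ≡⟨ sym (vertex-remQuot x) ⟩
    uncurry vertex (remQuot k x)  ≡⟨ cong (uncurry vertex) (cong₂ _,_ (cong proj₁ e) (toℕ-injective (cong proj₂ e))) ⟩
    uncurry vertex (remQuot k y)  ≡⟨ vertex-remQuot y ⟩
    y                             ∎
    where open ≡-Reasoning

  tournament : IsTournament Tₖ
  tournament = (λ x → ⌊⌋-false (beats? _ _) (λ u⟶u → beats-asym u⟶u u⟶u))
             , (λ x y x≢y → ⌊⌋-exclusive (beats? _ _) (beats? _ _) beats-asym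
                                           (beats-total (x≢y ∘ position-injective)))

  arc⇒beats : ∀ {X Y i j} → Arc Tₖ (vertex X i) (vertex Y j) → Beats (X , toℕ i) (Y , toℕ j)
  arc⇒beats {X} {Y} {i} {j} = toWitness ∘ subst₂ (λ u v → True (beats? u v)) (position-vertex X i) (position-vertex Y j)

  beats⇒arc : ∀ {X Y i j} → Beats (X , toℕ i) (Y , toℕ j) → Arc Tₖ (vertex X i) (vertex Y j)
  beats⇒arc {X} {Y} {i} {j} = subst₂ (λ u v → True (beats? u v)) (sym (position-vertex X i)) (sym (position-vertex Y j)) ∘ fromWitness

  triangle⇒cycle : ∀ {X Y Z i j l} → Triangle Tₖ (vertex X i) (vertex Y j) (vertex Z l) →
                   Cycle (X , toℕ i) (Y , toℕ j) (Z , toℕ l)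
  triangle⇒cycle (u⟶v , v⟶w , w⟶u) = arc⇒beats u⟶v , arc⇒beats v⟶w , arc⇒beats w⟶u

  cycle⇒triangle : ∀ X i Y j Z l → Cycle (X , toℕ i) (Y , toℕ j) (Z , toℕ l) →
                   Triangle Tₖ (vertex X i) (vertex Y j) (vertex Z l)
  cycle⇒triangle _ _ _ _ _ _ (u⟶v , v⟶w , w⟶u) = beats⇒arc u⟶v , beats⇒arc v⟶w , beats⇒arc w⟶u

  data View : Fin (3 * k) → Set where
    at : ∀ X i → View (vertex X i)

  view : ∀ x → View x
  view x = subst View (vertex-remQuot x) (at (proj₁ (remQuot {3} k x)) (proj₂ (remQuot {3} k x)))

  indexColouring : Vec (Fin k) k → Coloring k Tₖ
  indexColouring p = tabulate (lookup p ∘ proj₂ ∘ remQuot {3} k)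

  indexColouring-vertex : ∀ p X i → lookup (indexColouring p) (vertex X i) ≡ lookup p i
  indexColouring-vertex p X i = trans (lookup∘tabulate (lookup p ∘ proj₂ ∘ remQuot {3} k) (vertex X i)) (cong (lookup p ∘ proj₂) (remQuot-vertex X i))

  indexColouring-injective : Injective _≡_ _≡_ indexColouring
  indexColouring-injective {p} {q} e = lookup-extensionality λ i →
    trans (sym (indexColouring-vertex p B i)) (trans (cong (λ α → lookup α (vertex B i)) e) (indexColouring-vertex q B i))

  triangle-to-index : ∀ X {i m : Fin k} → i ≢ m → ∃₂ λ Y Z → Triangle Tₖ (vertex X i) (vertex Y m) (vertex Z m)
  triangle-to-index X {i} {m} i≢m with <-cmp (toℕ i) (toℕ m) | X
  ... | tri≈ _ i≡m _ | _ = ⊥-elim (i≢m (toℕ-injective i≡m))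
  ... | tri< i<m _ _ | A = A , B , cycle⇒triangle A i A m B m (i<m , ≤-refl , i<m)
  ... | tri> _ _ m<i | A = B , C , cycle⇒triangle A i B m C m (<⇒≤ m<i , ≤-refl , m<i)
  ... | tri< i<m _ _ | B = B , C , cycle⇒triangle B i B m C m (i<m , ≤-refl , i<m)
  ... | tri> _ _ m<i | B = A , B , cycle⇒triangle B i A m B m (m<i , ≤-refl , m<i)
  ... | tri< i<m _ _ | C = A , B , cycle⇒triangle C i A m B m (i<m , ≤-refl , <⇒≤ i<m)
  ... | tri> _ _ m<i | C = B , C , cycle⇒triangle C i B m C m (m<i , ≤-refl , m<i)

  module _ {p : Vec (Fin k) k} (p-injective : Injective _≡_ _≡_ (lookup p)) where

    indexColouring-valid : IsKColoring k Tₖ (indexColouring p)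
    indexColouring-valid j = rank⇒acyclic Tₖ _ (toℕ ∘ proj₁ ∘ position) increasing
      where
      increasing : ∀ {x y} → lookup (indexColouring p) x ≡ j → lookup (indexColouring p) y ≡ j → Arc Tₖ x y →
                   toℕ (proj₁ (position x)) < toℕ (proj₁ (position y))
      increasing {x} {y} x∈j y∈j x⟶y with view x | view y
      ... | at X i | at Y i′ with refl ← p-injective (trans (sym (indexColouring-vertex p X i))
                                        (trans x∈j (trans (sym y∈j) (indexColouring-vertex p Y i′))))
        = subst₂ (λ u v → toℕ (proj₁ u) < toℕ (proj₁ v)) (sym (position-vertex X i)) (sym (position-vertex Y i))
                 (same-index-beats (arc⇒beats {X} {Y} {i} {i} x⟶y))

    indexColouring-frozen : Frozen Tₖ (indexColouring p)
    indexColouring-frozen v j v≢j with view v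
    ... | at X i with m , pm≡j ← injective⇒surjective p-injective j
                 with Y , Z , triangle ← triangle-to-index X {i} {m} (λ { refl → v≢j (trans (indexColouring-vertex p X i) pm≡j) })
      = vertex Y m , vertex Z m , coloured Y , coloured Z , triangle
      where
      coloured : ∀ Y → lookup (indexColouring p) (vertex Y m) ≡ j
      coloured Y = trans (indexColouring-vertex p Y m) pm≡j

    indexColouring-isolated : Isolated k Tₖ (indexColouring p)
    indexColouring-isolated = frozen⇒isolated Tₖ (indexColouring p) indexColouring-valid indexColouring-frozen

  freezable : Freezable k Tₖ
  freezable = indexColouring (allFinᵥ k) ,
              indexColouring-isolated {allFinᵥ k} (λ {i} {j} e → trans (sym (lookup-allFin i)) (trans e (lookup-allFin j)))

  module _ (top : Fin k) (top-max : (i : Fin k) → toℕ i ≤ toℕ top)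
           (other : Fin k → Fin k) (other-≢ : (j : Fin k) → other j ≢ j) where

    module IsolatedColouring (α : Coloring k Tₖ) (α-isolated : Isolated k Tₖ α) where

      colour : Block → Fin k → Fin k
      colour X i = lookup α (vertex X i)

      frozen : Frozen Tₖ α
      frozen = Tournament.isolated⇒frozen Tₖ tournament α α-isolated

      colour-on-B : ∀ {X i j} → X ≢ B → colour X i ≢ j → ∃ λ m → colour B m ≡ j
      colour-on-B {X} {i} {j} X≢B Xi≢j =
        let y , z , y∈j , z∈j , triangle = frozen (vertex X i) j Xi≢j in on-B (view y) (view z) y∈j z∈j triangle
        where
        on-B : ∀ {y z} → View y → View z → lookup α y ≡ j → lookup α z ≡ j → Triangle Tₖ (vertex X i) y z →
               ∃ λ m → colour B m ≡ j
        on-B (at Y i₁) (at Z i₂) y∈j z∈j triangle with cycle-meets-B X≢B (triangle⇒cycle triangle)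
        ... | inj₁ refl = i₁ , y∈j
        ... | inj₂ refl = i₂ , z∈j

      -- If A_top has colour j, recolour it: the triangle created ends with an arc into A_top, which no
      -- vertex of B has, so it passes through a vertex outside B whose colour is not j.
      B-surjective : Onto (colour B)
      B-surjective j = from-top (colour A top ≟ᶠ j)
        where
        via : ∀ {z} → View z → lookup α z ≡ other j → Arc Tₖ z (vertex A top) → ∃ λ m → colour B m ≡ j
        via (at A l) z∈other _ = colour-on-B {A} {l} (λ ()) (other-≢ j ∘ trans (sym z∈other))
        via (at B l) _ z⟶top = ⊥-elim (<⇒≱ (arc⇒beats {B} {A} {l} {top} z⟶top) (top-max l))
        via (at C l) z∈other _ = colour-on-B {C} {l} (λ ()) (other-≢ j ∘ trans (sym z∈other))

        from-top : Dec (colour A top ≡ j) → ∃ λ m → colour B m ≡ j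
        from-top (no top≢j) = colour-on-B {A} {top} (λ ()) top≢j
        from-top (yes top≡j) =
          let _ , z , _ , z∈other , (_ , _ , z⟶top) = frozen (vertex A top) (other j) (λ e → other-≢ j (trans (sym e) top≡j))
          in via (view z) z∈other z⟶top

      B-injective : Injective _≡_ _≡_ (colour B)
      B-injective = surjective⇒injective B-surjective

      triangle-through-B : ∀ {X i m} → X ≢ B → colour X i ≢ colour B m →
                           ∃₂ λ Z l → Z ≢ B × colour Z l ≡ colour B m ×
                             (Cycle (X , toℕ i) (B , toℕ m) (Z , toℕ l) ⊎ Cycle (X , toℕ i) (Z , toℕ l) (B , toℕ m))
      triangle-through-B {X} {i} {m} X≢B Xi≢Bm =
        let y , z , y∈Bm , z∈Bm , triangle = frozen (vertex X i) (colour B m) Xi≢Bm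
        in other-vertex (view y) (view z) y∈Bm z∈Bm triangle
        where
        Result = ∃₂ λ Z l → Z ≢ B × colour Z l ≡ colour B m ×
                   (Cycle (X , toℕ i) (B , toℕ m) (Z , toℕ l) ⊎ Cycle (X , toℕ i) (Z , toℕ l) (B , toℕ m))

        from-blocks : ∀ {Y Z i₁ i₂} → Dec (Y ≡ B) → Dec (Z ≡ B) → colour Y i₁ ≡ colour B m → colour Z i₂ ≡ colour B m →
                      Cycle (X , toℕ i) (Y , toℕ i₁) (Z , toℕ i₂) → Result
        from-blocks (yes refl) (yes refl) y∈Bm z∈Bm (_ , i₁<i₂ , _) =
          ⊥-elim (<-irrefl (cong toℕ (trans (B-injective y∈Bm) (sym (B-injective z∈Bm)))) i₁<i₂)
        from-blocks {Z = Z} {i₂ = i₂} (yes refl) (no Z≢B) y∈Bm z∈Bm cycle =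
          Z , i₂ , Z≢B , z∈Bm , inj₁ (subst (λ i₁ → Cycle (X , toℕ i) (B , toℕ i₁) (Z , toℕ i₂)) (B-injective y∈Bm) cycle)
        from-blocks {Y = Y} {i₁ = i₁} (no Y≢B) (yes refl) y∈Bm z∈Bm cycle =
          Y , i₁ , Y≢B , y∈Bm , inj₂ (subst (λ i₂ → Cycle (X , toℕ i) (Y , toℕ i₁) (B , toℕ i₂)) (B-injective z∈Bm) cycle)
        from-blocks (no Y≢B) (no Z≢B) _ _ cycle = ⊥-elim (outside-B-acyclic X≢B Y≢B Z≢B cycle)

        other-vertex : ∀ {y z} → View y → View z → lookup α y ≡ colour B m → lookup α z ≡ colour B m →
                       Triangle Tₖ (vertex X i) y z → Result
        other-vertex (at Y _) (at Z _) y∈Bm z∈Bm triangle = from-blocks (Y ≟B) (Z ≟B) y∈Bm z∈Bm (triangle⇒cycle triangle)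

      -- A_l needs a triangle with B_m, whose third vertex beats B_m and so forms a triangle with B_m and C_l.
      C-below-excluded : ∀ {l m} → toℕ l < toℕ m → colour A l ≡ colour B l → colour C l ≢ colour B m
      C-below-excluded {l} {m} l<m Al≡Bl Cl≡Bm =
        let Z , l′ , Z≢B , Zl′≡Bm , cycle = triangle-through-B {A} {l} {m} (λ ()) Al≢Bm in excluded Z≢B Zl′≡Bm cycle
        where
        Al≢Bm : colour A l ≢ colour B m
        Al≢Bm e = <⇒≢ᶠ l<m (B-injective (trans (sym Al≡Bl) e))

        excluded : ∀ {Z l′} → Z ≢ B → colour Z l′ ≡ colour B m →
                   ¬ (Cycle (A , toℕ l) (B , toℕ m) (Z , toℕ l′) ⊎ Cycle (A , toℕ l) (Z , toℕ l′) (B , toℕ m))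
        excluded _ _ (inj₁ (m≤l , _)) = <⇒≱ l<m m≤l
        excluded {Z} {l′} Z≢B Zl′≡Bm (inj₂ (_ , Zl′⟶Bm , _)) =
          no-monochromatic-triangle Tₖ α (proj₁ α-isolated) (sym Cl≡Bm) (trans Cl≡Bm (sym Zl′≡Bm))
            (cycle⇒triangle B m C l Z l′ (<⇒≤ l<m , C-beats Z Z≢B Zl′⟶Bm , Zl′⟶Bm))
          where
          C-beats : ∀ Z → Z ≢ B → Beats (Z , toℕ l′) (B , toℕ m) → Beats (C , toℕ l) (Z , toℕ l′)
          C-beats A _ m≤l′ = <-≤-trans l<m m≤l′
          C-beats B B≢B _ = ⊥-elim (B≢B refl)
          C-beats C _ m<l′ = <-trans l<m m<l′

      A-agrees : ∀ m → colour A m ≡ colour B m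
      A-agrees = WF.All.wfRec <-wellFounded 0ℓ _ λ m below →
        decidable-stable (colour A m ≟ᶠ colour B m) λ Am≢Bm →
          let Z , l , Z≢B , Zl≡Bm , cycle = triangle-through-B {A} {m} {m} (λ ()) Am≢Bm
          in impossible below Z≢B Zl≡Bm cycle
        where
        impossible : ∀ {m Z l} → (∀ {l} → l <ᶠ m → colour A l ≡ colour B l) → Z ≢ B → colour Z l ≡ colour B m →
                     ¬ (Cycle (A , toℕ m) (B , toℕ m) (Z , toℕ l) ⊎ Cycle (A , toℕ m) (Z , toℕ l) (B , toℕ m))
        impossible {Z = A} below _ Al≡Bm (inj₁ (_ , _ , l<m)) = <⇒≢ᶠ l<m (B-injective (trans (sym (below l<m)) Al≡Bm))
        impossible {Z = B} _ B≢B _ _ = B≢B refl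
        impossible {Z = C} below _ Cl≡Bm (inj₁ (_ , _ , l<m)) = C-below-excluded l<m (below l<m) Cl≡Bm
        impossible _ _ _ (inj₂ (_ , _ , m<m)) = <-irrefl refl m<m

      C-agrees : ∀ m → colour C m ≡ colour B m
      C-agrees = WF.All.wfRec >-wellFounded 0ℓ _ λ m above →
        decidable-stable (colour C m ≟ᶠ colour B m) λ Cm≢Bm →
          let Z , l , Z≢B , Zl≡Bm , cycle = triangle-through-B {C} {m} {m} (λ ()) Cm≢Bm
          in impossible above Z≢B Zl≡Bm cycle
        where
        impossible : ∀ {m Z l} → (∀ {l} → l >ᶠ m → colour C l ≡ colour B l) → Z ≢ B → colour Z l ≡ colour B m →
                     ¬ (Cycle (C , toℕ m) (B , toℕ m) (Z , toℕ l) ⊎ Cycle (C , toℕ m) (Z , toℕ l) (B , toℕ m))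
        impossible _ _ _ (inj₁ (m<m , _)) = <-irrefl refl m<m
        impossible {Z = A} {l} _ _ Al≡Bm (inj₂ (m<l , _)) = <⇒≢ᶠ m<l (sym (B-injective (trans (sym (A-agrees l)) Al≡Bm)))
        impossible {Z = B} _ B≢B _ _ = B≢B refl
        impossible {Z = C} above _ Cl≡Bm (inj₂ (m<l , _)) = <⇒≢ᶠ m<l (sym (B-injective (trans (sym (above m<l)) Cl≡Bm)))

      permutation : Vec (Fin k) k
      permutation = tabulate (colour B)

      permutation-injective : Injective _≡_ _≡_ (lookup permutation)
      permutation-injective {i} {j} e = B-injective (trans (sym (lookup∘tabulate (colour B) i)) (trans e (lookup∘tabulate (colour B) j)))

      α≡indexColouring : α ≡ indexColouring permutation
      α≡indexColouring = lookup-extensionality pointwise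
        where
        agrees : ∀ X i → colour X i ≡ colour B i
        agrees A = A-agrees
        agrees B _ = refl
        agrees C = C-agrees

        pointwise : ∀ x → lookup α x ≡ lookup (indexColouring permutation) x
        pointwise x with view x
        ... | at X i = trans (agrees X i) (sym (trans (indexColouring-vertex permutation X i) (lookup∘tabulate (colour B) i)))

    isolated-colourings : HasExactlyIsolated (k !) k Tₖ
    isolated-colourings =
      map indexColouring (permutations k) ,
      unique-map⁺ indexColouring-injective (permutations-unique k) ,
      trans (length-map indexColouring (permutations k)) (length-permutations k) ,
      λ α → mk⇔ (isolated⇒∈ α) ∈⇒isolated
      where
      isolated⇒∈ : ∀ α → Isolated k Tₖ α → α ∈ map indexColouring (permutations k)
      isolated⇒∈ α α-isolated =
        subst (_∈ map indexColouring (permutations k)) (sym α≡indexColouring)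
              (∈-map⁺ indexColouring (∈-permutations⁺ {p = permutation} permutation-injective))
        where open IsolatedColouring α α-isolated

      ∈⇒isolated : ∀ {α} → α ∈ map indexColouring (permutations k) → Isolated k Tₖ α
      ∈⇒isolated α∈ with p , p∈ , refl ← ∈-map⁻ indexColouring α∈ = indexColouring-isolated {p} (∈-permutations⁻ p∈)

k!-isolated-colourings : (k : ℕ) → 2 ≤ k → ∃ λ T → IsTournament T × Freezable k T × HasExactlyIsolated (k !) k T
k!-isolated-colourings (suc (suc k′)) (s≤s (s≤s z≤n)) =
  Tₖ , tournament , freezable , isolated-colourings top top-max other other-≢
  where
  open BlockTournament (suc (suc k′))

  top : Fin (suc (suc k′))
  top = fromℕ (suc k′)

  top-max : ∀ i → toℕ i ≤ toℕ top
  top-max i = subst (toℕ i ≤_) (sym (toℕ-fromℕ (suc k′))) (toℕ≤pred[n] i)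

  other : Fin (suc (suc k′)) → Fin (suc (suc k′))
  other zero    = suc zero
  other (suc _) = zero

  other-≢ : ∀ j → other j ≢ j
  other-≢ zero    ()
  other-≢ (suc _) ()

-- The tournament C⃗_{2n+1}⟨n⟩ − {0}

≢⇒≡opposite : ∀ {a b : Fin 2} → a ≢ b → a ≡ opposite b
≢⇒≡opposite {zero}      {zero}      a≢b = ⊥-elim (a≢b refl)
≢⇒≡opposite {zero}      {suc zero}  _   = refl
≢⇒≡opposite {suc zero}  {zero}      _   = refl
≢⇒≡opposite {suc zero}  {suc zero}  a≢b = ⊥-elim (a≢b refl)

opposite-≢ : ∀ (a : Fin 2) → opposite a ≢ a
opposite-≢ zero       ()
opposite-≢ (suc zero) ()

two-colours : ∀ {a b c : Fin 2} → a ≢ c → b ≢ c → a ≡ b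
two-colours a≢c b≢c = trans (≢⇒≡opposite a≢c) (sym (≢⇒≡opposite b≢c))

module CirculantMinusZero (r : ℕ) where

  q p M : ℕ
  q = 4 + r
  p = 3 + r
  M = suc (2 * q)

  D : Digraph
  D = CircMinus0 q

  -- vertex u stands for u + 1 ∈ ℤ_M (the vertex 0 is deleted); arguments u ≥ 2q give the junk value 0
  opaque
    vertex : ℕ → Fin (2 * q)
    vertex u with u <? 2 * q
    ... | yes u<2q = fromℕ< u<2q
    ... | no _     = zero

    toℕ-vertex : ∀ {u} → u < 2 * q → toℕ (vertex u) ≡ u
    toℕ-vertex {u} u<2q with u <? 2 * q
    ... | yes _     = toℕ-fromℕ< _
    ... | no  u≮2q = ⊥-elim (u≮2q u<2q)

  vertex-toℕ : ∀ x → vertex (toℕ x) ≡ x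
  vertex-toℕ x = toℕ-injective (toℕ-vertex (toℕ<n x))

  q+u<2q : ∀ {u} → u < q → q + u < 2 * q
  q+u<2q {u} u<q = subst (q + u <_) (cong (q +_) (sym (+-identityʳ q))) (+-monoʳ-< q u<q)

  -- circArc q (suc x) (suc y) unfolds to isJump (distance (toℕ x) (toℕ y))
  isJump : ℕ → Bool
  isJump d = ((1 ≤ᵇ d) ∧ (d ≤ᵇ p)) ∨ (d ≡ᵇ suc q)

  distance : ℕ → ℕ → ℕ
  distance a b = (b + M ∸ a) % M

  -- a → a + d is an arc for d ∈ {1, …, q - 1} ∪ {q + 1} (the reversed jump q, as a - q = a + q + 1 in ℤ_M),
  -- and a + d → a is an arc for the remaining differences d ∈ {q} ∪ {q + 2, …}
  data Forward : ℕ → Set where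
    short : ∀ {d} → 1 ≤ d → d ≤ p → Forward d
    long  : Forward (suc q)

  data Backward : ℕ → Set where
    halfway : Backward q
    far     : ∀ {d} → 2 + q ≤ d → Backward d

  M≡q+[1+q] : M ≡ q + suc q
  M≡q+[1+q] = trans (cong suc (cong (q +_) (+-identityʳ q))) (sym (+-suc q q))

  M≡[2+q]+p : M ≡ (2 + q) + p
  M≡[2+q]+p = cong suc (trans (cong (q +_) (+-identityʳ q)) (+-suc q p))

  forward⇒isJump : ∀ {d} → Forward d → T (isJump d)
  forward⇒isJump (short 1≤d d≤p) = Equivalence.from T-∨ (inj₁ (Equivalence.from T-∧ (≤⇒≤ᵇ 1≤d , ≤⇒≤ᵇ d≤p)))
  forward⇒isJump long = Equivalence.from T-∨ (inj₂ (≡⇒≡ᵇ (suc q) (suc q) refl))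

  isJump⇒forward : ∀ d → T (isJump d) → Forward d
  isJump⇒forward d jump with Equivalence.to T-∨ jump
  ... | inj₁ 1≤d≤p = let 1≤d , d≤p = Equivalence.to T-∧ 1≤d≤p in short (≤ᵇ⇒≤ 1 d 1≤d) (≤ᵇ⇒≤ d p d≤p)
  ... | inj₂ d≡q+1 rewrite ≡ᵇ⇒≡ d (suc q) d≡q+1 = long

  forward-positive : ∀ {d} → Forward d → 1 ≤ d
  forward-positive (short 1≤d _) = 1≤d
  forward-positive long          = s≤s z≤n

  forward-bounded : ∀ {d} → Forward d → d ≤ suc q
  forward-bounded (short _ d≤p) = ≤-trans d≤p (≤-trans (n≤1+n p) (n≤1+n q))
  forward-bounded long          = ≤-refl

  backward-positive : ∀ {d} → Backward d → 1 ≤ d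
  backward-positive halfway      = s≤s z≤n
  backward-positive (far 2+q≤d) = ≤-trans (s≤s z≤n) 2+q≤d

  backward⇒forward : ∀ {d} → Backward d → d < M → Forward (M ∸ d)
  backward⇒forward halfway _ = subst Forward (sym (trans (cong (_∸ q) M≡q+[1+q]) (m+n∸m≡n q (suc q)))) long
  backward⇒forward {d} (far 2+q≤d) d<M = short (m<n⇒0<n∸m d<M) (begin
    M ∸ d                 ≤⟨ ∸-monoʳ-≤ M 2+q≤d ⟩
    M ∸ (2 + q)           ≡⟨ cong (_∸ (2 + q)) M≡[2+q]+p ⟩
    (2 + q) + p ∸ (2 + q) ≡⟨ m+n∸m≡n (2 + q) p ⟩
    p                     ∎)
    where open ≤-Reasoning

  distance-up : ∀ a d → d + a < M → distance a (d + a) ≡ d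
  distance-up a d d+a<M = begin
    (d + a + M ∸ a) % M   ≡⟨ cong (λ m → (m ∸ a) % M) (trans (cong (_+ M) (+-comm d a)) (+-assoc a d M)) ⟩
    (a + (d + M) ∸ a) % M ≡⟨ cong (_% M) (m+n∸m≡n a (d + M)) ⟩
    (d + M) % M           ≡⟨ [m+n]%n≡m%n d M ⟩
    d % M                 ≡⟨ m<n⇒m%n≡m (≤-<-trans (m≤m+n d a) d+a<M) ⟩
    d                     ∎
    where open ≡-Reasoning

  distance-down : ∀ a d → 1 ≤ d → d ≤ M → distance (d + a) a ≡ M ∸ d
  distance-down a d 1≤d d≤M = begin
    (a + M ∸ (d + a)) % M ≡⟨ cong (λ m → (a + M ∸ m) % M) (+-comm d a) ⟩
    (a + M ∸ (a + d)) % M ≡⟨ cong (_% M) ([m+n]∸[m+o]≡n∸o a M d) ⟩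
    (M ∸ d) % M           ≡⟨ m<n⇒m%n≡m (∸-monoʳ-< {M} {d} {0} 1≤d d≤M) ⟩
    M ∸ d                 ∎
    where open ≡-Reasoning

  arc-between : ∀ {a b} → a < 2 * q → b < 2 * q → T (isJump (distance a b)) → Arc D (vertex a) (vertex b)
  arc-between a<2q b<2q = subst₂ (λ a b → T (isJump (distance a b))) (sym (toℕ-vertex a<2q)) (sym (toℕ-vertex b<2q))

  <2q⇒<M : ∀ {a} → a < 2 * q → a < M
  <2q⇒<M a<2q = <-trans a<2q (n<1+n _)

  forward-arc : ∀ {a d} → Forward d → d + a < 2 * q → Arc D (vertex a) (vertex (d + a))
  forward-arc {a} {d} forward d+a<2q =
    arc-between (≤-<-trans (m≤n+m a d) d+a<2q) d+a<2q
      (subst (T ∘ isJump) (sym (distance-up a d (<2q⇒<M d+a<2q))) (forward⇒isJump forward))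

  backward-arc : ∀ {a d} → Backward d → d + a < 2 * q → Arc D (vertex (d + a)) (vertex a)
  backward-arc {a} {d} backward d+a<2q =
    arc-between d+a<2q (≤-<-trans (m≤n+m a d) d+a<2q)
      (subst (T ∘ isJump) (sym (distance-down a d (backward-positive backward) (<⇒≤ d<M)))
        (forward⇒isJump (backward⇒forward backward d<M)))
    where
    d<M : d < M
    d<M = <2q⇒<M (≤-<-trans (m≤m+n d a) d+a<2q)

  triangle : ∀ {a b c x y d} → Forward x → Forward y → Backward d →
             x + a ≡ b → y + b ≡ c → d + a ≡ c → c < 2 * q → Triangle D (vertex a) (vertex b) (vertex c)
  triangle {a} {b} {y = y} fx fy bd refl refl d+a≡c c<2q =
    forward-arc fx (≤-<-trans (m≤n+m b y) c<2q) ,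
    forward-arc fy c<2q ,
    subst (λ c → Arc D (vertex c) (vertex a)) d+a≡c (backward-arc bd (subst (_< 2 * q) (sym d+a≡c) c<2q))

  no-short-descent : ∀ {x y} → toℕ y ≤ toℕ x → toℕ x ∸ toℕ y ≤ p → ¬ Arc D x y
  no-short-descent {x} {y} y≤x x-y≤p x⟶y =
    descent (toℕ y) (toℕ x ∸ toℕ y) x-y≤p (subst (λ a → T (isJump (distance a (toℕ y)))) (sym (m∸n+n≡m y≤x)) x⟶y)
    where
    descent : ∀ b e → e ≤ p → ¬ T (isJump (distance (e + b) b))
    descent b zero _ jump =
      1+n≰n (forward-positive (isJump⇒forward 0 (subst (T ∘ isJump) (trans (cong (_% M) (m+n∸m≡n b M)) (n%n≡0 M)) jump)))
    descent b (suc e) 1+e≤p jump = <⇒≱ 2+q≤M∸e (forward-bounded (isJump⇒forward _ (subst (T ∘ isJump) (distance-down b (suc e) (s≤s z≤n) e≤M) jump)))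
      where
      e≤M : suc e ≤ M
      e≤M = ≤-trans 1+e≤p (≤-trans (m≤n+m p (2 + q)) (≤-reflexive (sym M≡[2+q]+p)))
      2+q≤M∸e : 2 + q ≤ M ∸ suc e
      2+q≤M∸e = ≤-trans (≤-reflexive (sym (trans (cong (_∸ p) M≡[2+q]+p) (m+n∸n≡m (2 + q) p)))) (∸-monoʳ-≤ M 1+e≤p)

  short-suc : ∀ {e} → e ≤ 2 + r → Forward (suc e)
  short-suc e≤2+r = short (s≤s z≤n) (s≤s e≤2+r)

  antipodal-triangle : ∀ {u i j b} → i + j ≡ q → 1 ≤ i → 1 ≤ j → i + u ≡ b → u < q → Triangle D (vertex u) (vertex b) (vertex (q + u))
  antipodal-triangle {u} {i} {j} i+j≡q 1≤i 1≤j i+u≡b u<q =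
    triangle (short 1≤i (below i+j≡q 1≤j)) (short 1≤j (below (trans (+-comm j i) i+j≡q) 1≤i)) halfway
             i+u≡b (trans (cong (j +_) (sym i+u≡b)) (trans (sym (+-assoc j i u)) (cong (_+ u) (trans (+-comm j i) i+j≡q))))
             refl (q+u<2q u<q)
    where
    below : ∀ {i j} → i + j ≡ q → 1 ≤ j → i ≤ p
    below {i} {suc j} i+j≡q _ = subst (i ≤_) (suc-injective (trans (sym (+-suc i j)) i+j≡q)) (m≤m+n i j)

  step-triangle : ∀ s → 2 + s < q → Triangle D (vertex s) (vertex (1 + s)) (vertex (q + (2 + s)))
  step-triangle s 2+s<q = triangle (short-suc z≤n) long (far ≤-refl) refl (xy∙z≈y∙xz 1 q (1 + s)) (xy∙z≈y∙xz 2 q s) (q+u<2q 2+s<q)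

  leap-triangle : ∀ u → 2 + u < q → Triangle D (vertex u) (vertex (q + (1 + u))) (vertex (q + (2 + u)))
  leap-triangle u 2+u<q = triangle long (short-suc z≤n) (far ≤-refl) (xy∙z≈y∙xz 1 q u) (xy∙z≈y∙xz 1 q (1 + u)) (xy∙z≈y∙xz 2 q u) (q+u<2q 2+u<q)

  side : Fin 2 → ℕ → Fin 2
  side z u with u <? q
  ... | yes _ = z
  ... | no  _ = opposite z

  -- vertices 1, …, q of ℤ_M get colour z, vertices q + 1, …, 2q the other colour
  halves : Fin 2 → Coloring 2 D
  halves z = tabulate (side z ∘ toℕ)

  halves-lower : ∀ z {x} → toℕ x < q → lookup (halves z) x ≡ z
  halves-lower z {x} x<q with toℕ x <? q | lookup∘tabulate (side z ∘ toℕ) x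
  ... | yes _   | eq = eq
  ... | no  x≮q | _  = ⊥-elim (x≮q x<q)

  halves-upper : ∀ z {x} → q ≤ toℕ x → lookup (halves z) x ≡ opposite z
  halves-upper z {x} q≤x with toℕ x <? q | lookup∘tabulate (side z ∘ toℕ) x
  ... | yes x<q | _  = ⊥-elim (<⇒≱ x<q q≤x)
  ... | no  _   | eq = eq

  upper-offset : ∀ (x : Fin (2 * q)) → q ≤ toℕ x → toℕ x ∸ q < q
  upper-offset x q≤x = +-cancelˡ-< q _ _ (subst₂ _<_ (sym (m+[n∸m]≡n q≤x)) 2q≡q+q (toℕ<n x))
    where
    2q≡q+q : 2 * q ≡ q + q
    2q≡q+q = cong (q +_) (+-identityʳ q)

  module ColouringAnalysis (α : Coloring 2 D) (α-col : IsKColoring 2 D α) where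

    colour : ℕ → Fin 2
    colour u = lookup α (vertex u)

    not-monochromatic : ∀ {a b c} → Triangle D (vertex a) (vertex b) (vertex c) → colour a ≡ colour b → ¬ colour b ≡ colour c
    not-monochromatic abc ab bc = no-monochromatic-triangle D α α-col ab bc abc

    antipodes-differ-low : ∀ {u} → 3 + u ≤ q → colour u ≢ colour (q + u)
    antipodes-differ-low {u} 3+u≤q u≡q+u = not-monochromatic (leap-triangle u 2+u<q) (sym up₁) (trans up₁ (sym up₂))
      where
      2+u<q : 2 + u < q
      2+u<q = 3+u≤q
      1+u<q = <-trans (n<1+n _) 2+u<q
      u<q = <-trans (n<1+n _) 1+u<q

      inside : ∀ {i j} → i + j ≡ q → 1 ≤ i → 1 ≤ j → colour (i + u) ≢ colour u
      inside i+j≡q 1≤i 1≤j e = not-monochromatic (antipodal-triangle i+j≡q 1≤i 1≤j refl u<q) (sym e) (trans e u≡q+u)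

      d₁ = inside {1} {3 + r} refl (s≤s z≤n) (s≤s z≤n)
      d₂ = inside {2} {2 + r} refl (s≤s z≤n) (s≤s z≤n)
      d₃ = inside {3} {1 + r} refl (s≤s z≤n) (s≤s z≤n)

      up₁ : colour (q + (1 + u)) ≡ colour u
      up₁ = two-colours (λ e → not-monochromatic (antipodal-triangle {1 + u} {1} {p} refl (s≤s z≤n) (s≤s z≤n) refl 1+u<q) (two-colours d₁ d₂) (sym e)) (d₂ ∘ sym)

      up₂ : colour (q + (2 + u)) ≡ colour u
      up₂ = two-colours (λ e → not-monochromatic (antipodal-triangle {2 + u} {1} {p} refl (s≤s z≤n) (s≤s z≤n) refl 2+u<q) (two-colours d₂ d₃) (sym e)) (d₃ ∘ sym)

    antipodes-differ-high : ∀ s → 2 + s < q → colour (2 + s) ≢ colour (q + (2 + s))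
    antipodes-differ-high s 2+s<q u≡q+u = not-monochromatic (step-triangle s 2+s<q) (trans down₀ (sym down₁)) (trans down₁ u≡q+u)
      where
      u = 2 + s
      1+s<q = <-trans (n<1+n _) 2+s<q
      s<q = <-trans (n<1+n _) 1+s<q

      inside : ∀ {i j b} → i + j ≡ q → 1 ≤ i → 1 ≤ j → i + u ≡ b → colour b ≢ colour u
      inside i+j≡q 1≤i 1≤j i+u≡b e = not-monochromatic (antipodal-triangle i+j≡q 1≤i 1≤j i+u≡b 2+s<q) (sym e) (trans e u≡q+u)

      d₁ : colour (q + (1 + s)) ≢ colour u
      d₁ = inside {p} {1} (+-comm p 1) (s≤s z≤n) (s≤s z≤n) (+-suc p (1 + s))
      d₂ : colour (q + s) ≢ colour u
      d₂ = inside {2 + r} {2} (+-comm (2 + r) 2) (s≤s z≤n) (s≤s z≤n) (sym (xy∙z≈y∙xz 2 (2 + r) s))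
      d₃ : colour (p + s) ≢ colour u
      d₃ = inside {1 + r} {3} (+-comm (1 + r) 3) (s≤s z≤n) (s≤s z≤n) (sym (xy∙z≈y∙xz 2 (1 + r) s))

      down₁ : colour (1 + s) ≡ colour u
      down₁ = two-colours (λ e → not-monochromatic (antipodal-triangle {1 + s} {p} {1} (+-comm p 1) (s≤s z≤n) (s≤s z≤n) (sym (xy∙z≈y∙xz 1 p s)) 1+s<q)
                                                   e (two-colours d₂ d₁))
                          (d₂ ∘ sym)

      down₀ : colour s ≡ colour u
      down₀ = two-colours (λ e → not-monochromatic (antipodal-triangle {s} {p} {1} (+-comm p 1) (s≤s z≤n) (s≤s z≤n) refl s<q)
                                                   e (two-colours d₃ d₂))
                          (d₃ ∘ sym)

    antipodes-differ : ∀ u → u < q → colour u ≢ colour (q + u)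
    antipodes-differ zero          _     = antipodes-differ-low (s≤s (s≤s (s≤s z≤n)))
    antipodes-differ (suc zero)    _     = antipodes-differ-low (s≤s (s≤s (s≤s (s≤s z≤n))))
    antipodes-differ (suc (suc s)) 2+s<q = antipodes-differ-high s 2+s<q

    neighbours-agree : ∀ u → 1 + u < q → colour u ≡ colour (1 + u)
    neighbours-agree zero    _     = decidable-stable (colour 0 ≟ᶠ colour 1) base
      where
      base : ¬ colour 0 ≢ colour 1
      base 0≢1 = not-monochromatic second (sym q≡1) (two-colours (a₀ ∘ sym) (q+3≢0))
        where
        a₀ = antipodes-differ 0 (s≤s z≤n)
        a₁ = antipodes-differ 1 (s≤s (s≤s z≤n))
        q+1≡0 : colour (q + 1) ≡ colour 0
        q+1≡0 = two-colours (a₁ ∘ sym) 0≢1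
        q≡1 : colour (q + 0) ≡ colour 1
        q≡1 = two-colours (a₀ ∘ sym) (0≢1 ∘ sym)
        3<q : 3 < q
        3<q = s≤s (s≤s (s≤s (s≤s z≤n)))
        first : Triangle D (vertex 0) (vertex (q + 1)) (vertex (q + 3))
        first = triangle long (short-suc (s≤s z≤n)) (far (n≤1+n _)) (xy∙z≈y∙xz 1 q 0) (xy∙z≈y∙xz 2 q 1) (xy∙z≈y∙xz 3 q 0) (q+u<2q 3<q)
        second : Triangle D (vertex 1) (vertex (q + 0)) (vertex (q + 3))
        second = triangle (short-suc ≤-refl) (short-suc (s≤s (s≤s z≤n))) (far ≤-refl)
                          (trans (+-comm p 1) (sym (+-identityʳ q))) (xy∙z≈y∙xz 3 q 0) (xy∙z≈y∙xz 2 q 1) (q+u<2q 3<q)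
        q+3≢0 : colour (q + 3) ≢ colour 0
        q+3≢0 e = not-monochromatic first (sym q+1≡0) (trans q+1≡0 (sym e))
    neighbours-agree (suc s) 2+s<q = decidable-stable (colour (1 + s) ≟ᶠ colour (2 + s)) λ 1+s≢2+s →
      not-monochromatic (step-triangle s 2+s<q) (neighbours-agree s (<-trans (n<1+n _) 2+s<q))
        (two-colours 1+s≢2+s (antipodes-differ (2 + s) 2+s<q ∘ sym))

    lower-half : ∀ u → u < q → colour u ≡ colour 0
    lower-half zero    _       = refl
    lower-half (suc u) 1+u<q = trans (sym (neighbours-agree u 1+u<q)) (lower-half u (<-trans (n<1+n u) 1+u<q))

    α≡halves : α ≡ halves (colour 0)
    α≡halves = lookup-extensionality pointwise
      where
      pointwise : ∀ x → lookup α x ≡ lookup (halves (colour 0)) x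
      pointwise x with toℕ x <? q
      ... | yes x<q = trans (cong (lookup α) (sym (vertex-toℕ x)))
                            (trans (lower-half (toℕ x) x<q) (sym (halves-lower (colour 0) x<q)))
      ... | no  x≮q = trans (cong (lookup α) (sym (trans (cong vertex (m+[n∸m]≡n q≤x)) (vertex-toℕ x))))
                            (trans (≢⇒≡opposite upper≢0) (sym (halves-upper (colour 0) q≤x)))
        where
        q≤x = ≮⇒≥ x≮q
        v<q = upper-offset x q≤x
        upper≢0 : colour (q + (toℕ x ∸ q)) ≢ colour 0
        upper≢0 e = antipodes-differ _ v<q (trans (lower-half _ v<q) (sym e))

  same-half : ∀ {z x y} → lookup (halves z) x ≡ lookup (halves z) y → toℕ y ≤ toℕ x → toℕ x ∸ toℕ y ≤ p
  same-half {z} {x} {y} same y≤x with toℕ x <? q | toℕ y <? q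
  ... | yes x<q | _       = ≤-trans (m∸n≤m (toℕ x) (toℕ y)) (≤-pred x<q)
  ... | no  x≮q | no  y≮q = ≤-pred (≤-<-trans (∸-monoʳ-≤ (toℕ x) (≮⇒≥ y≮q)) (upper-offset x (≮⇒≥ x≮q)))
  ... | no  x≮q | yes y<q = ⊥-elim (opposite-≢ z (trans (sym (halves-upper z (≮⇒≥ x≮q))) (trans same (halves-lower z y<q))))

  halves-valid : ∀ z → IsKColoring 2 D (halves z)
  halves-valid z i = rank⇒acyclic D _ toℕ ascending
    where
    ascending : ∀ {x y} → lookup (halves z) x ≡ i → lookup (halves z) y ≡ i → Arc D x y → toℕ x < toℕ y
    ascending {x} {y} x∈i y∈i x⟶y with toℕ y ≤? toℕ x
    ... | no  y≰x = ≰⇒> y≰x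
    ... | yes y≤x = ⊥-elim (no-short-descent y≤x (same-half (trans x∈i (sym y∈i)) y≤x) x⟶y)

  halves-injective-at : ∀ {z z′} x → lookup (halves z) x ≡ lookup (halves z′) x → z ≡ z′
  halves-injective-at {z} {z′} x same with toℕ x <? q
  ... | yes x<q = trans (sym (halves-lower z x<q)) (trans same (halves-lower z′ x<q))
  ... | no  x≮q = opposite-injective (trans (sym (halves-upper z (≮⇒≥ x≮q))) (trans same (halves-upper z′ (≮⇒≥ x≮q))))
    where
    opposite-injective : ∀ {a b : Fin 2} → opposite a ≡ opposite b → a ≡ b
    opposite-injective {zero}     {zero}     _ = refl
    opposite-injective {suc zero} {suc zero} _ = refl
    opposite-injective {zero}     {suc zero} ()
    opposite-injective {suc zero} {zero}     ()

  halves-isolated : ∀ z → Isolated 2 D (halves z)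
  halves-isolated z = halves-valid z , not-adjacent
    where
    another : (v : Fin (2 * q)) → ∃ λ w → w ≢ v
    another zero    = suc zero , λ ()
    another (suc _) = zero , λ ()

    not-adjacent : ∀ β → ¬ Adjacent 2 D (halves z) β
    not-adjacent β (_ , β-col , v , differ , agree) = differ (cong (λ γ → lookup γ v) halves-z≡β)
      where
      open ColouringAnalysis β β-col using (α≡halves)
      w = proj₁ (another v)
      halves-z≡β : halves z ≡ β
      halves-z≡β = trans (cong halves (halves-injective-at w (trans (agree w (proj₂ (another v))) (cong (λ γ → lookup γ w) α≡halves))))
                         (sym α≡halves)

  colourings : ∀ α → IsKColoring 2 D α ⇔ α ∈ halves zero ∷ halves (suc zero) ∷ []
  colourings α = mk⇔ to from
    where
    member : ∀ z → α ≡ halves z → α ∈ halves zero ∷ halves (suc zero) ∷ []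
    member zero       α≡ = here α≡
    member (suc zero) α≡ = there (here α≡)

    to : IsKColoring 2 D α → α ∈ halves zero ∷ halves (suc zero) ∷ []
    to α-col = member _ (ColouringAnalysis.α≡halves α α-col)

    from : α ∈ halves zero ∷ halves (suc zero) ∷ [] → IsKColoring 2 D α
    from (here refl)         = halves-valid zero
    from (there (here refl)) = halves-valid (suc zero)

  two-isolated-colourings : Freezable 2 D × ConsistsOfIsolated 2 2 D
  two-isolated-colourings =
    (halves zero , halves-isolated zero) ,
    halves zero ∷ halves (suc zero) ∷ [] ,
    (halves-differ All.∷ All.[]) AllPairs.∷ All.[] AllPairs.∷ AllPairs.[] ,
    refl ,
    colourings ,
    halves-isolated zero All.∷ halves-isolated (suc zero) All.∷ All.[]
    where
    halves-differ : halves zero ≢ halves (suc zero)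
    halves-differ e with () ← halves-injective-at zero (cong (λ γ → lookup γ zero) e)

circulant-minus-zero : (n : ℕ) → 4 ≤ n → Freezable 2 (CircMinus0 n) × ConsistsOfIsolated 2 2 (CircMinus0 n)
circulant-minus-zero (suc (suc (suc (suc r)))) (s≤s (s≤s (s≤s (s≤s z≤n)))) =
  CirculantMinusZero.two-isolated-colourings r

corollary1 :
    ((k : ℕ) → 2 ≤ k →
      ∃ λ T → IsTournament T × Freezable k T × HasExactlyIsolated (k !) k T)
    × ((n : ℕ) → 4 ≤ n →
      Freezable 2 (CircMinus0 n) × ConsistsOfIsolated 2 2 (CircMinus0 n))
corollary1 = k!-isolated-colourings , circulant-minus-zero
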